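{- Let $(\mathcal{L}(P),\vdash)$ be a disjunctive sequent calculus. Then the set $|(\mathcal{L}(P),\vdash)|$ of its logical states, ordered by set inclusion, is a pointed dcpo (it has a least element and every directed subset has a supremum).
   Context: A disjunctive basis is $(P,\mathcal{A}_P)$ with $P$ a set of atomic formulae and $\mathcal{A}_P$ a set of sequents $p_1,\dots,p_n\vdash\mathrm{F}$, $p_i\in P$. Formulae $\mathcal{L}(P)$ and valid sequents $\Gamma\vdash\varphi$ ($\Gamma$ finite) are generated by simultaneous transfinite induction: atoms, $\mathrm{T}$, $\mathrm{F}$ are formulae; $\phi\wedge\psi$; $\dot{\bigvee}_{i\in I}\phi_i$ whenever $\phi_i,\phi_j\vdash\mathrm{F}$ valid for all $i\ne j$. Valid sequents: members of $\mathcal{A}_P$; $\phi\vdash\phi$; $\Gamma\vdash\psi\Rightarrow\Gamma,\phi\vdash\psi$; $\Gamma\vdash\phi,\ \Delta,\phi\vdash\psi\Rightarrow\Gamma,\Delta\vdash\psi$; $\mathrm{F}\vdash\phi$; $\vdash\mathrm{T}$; $\Gamma,\phi,\psi\vdash\theta\Rightarrow\Gamma,\phi\wedge\psi\vdash\theta$; $\Gamma\vdash\phi,\ \Delta\vdash\psi\Rightarrow\Gamma,\Delta\vdash\phi\wedge\psi$; for families with $\phi_i,\phi_j\vdash\mathrm{F}$ ($i\neq j$): ($\Gamma,\phi_i\vdash\theta$ for all $i$) $\Rightarrow\Gamma,\dot{\bigvee}_i\phi_i\vdash\theta$, and $\Gamma\vdash\phi_{i_0}\Rightarrow\Gamma\vdash\dot{\bigvee}_i\phi_i$.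 $X[\vdash]=\{\varphi:\Gamma\vdash\varphi\text{ valid for some finite }\Gamma\subseteq X\}$. Tautology: $\mathrm{T}\vdash\varphi$; contradiction: $\varphi\vdash\mathrm{F}$; satisfiable: neither. Conjunction: satisfiable formula built from atoms by $\wedge$ only. Flat formula: satisfiable $\dot{\bigvee}_i\mu_i$, $\mu_i$ conjunctions, $\mu_i,\mu_j\vdash\mathrm{F}$ for $i\ne j$. A logical state is a nonempty proper subset $S\subseteq\mathcal{L}(P)$ with (S1) a flat formula $\dot{\bigvee}_i\mu_i\in S$ implies $\mu_{i_0}\in S$ for some $i_0$; (S2) $S[\vdash]\subseteq S$. -}

module Defs where

open import Level using (0ℓ) renaming (suc to lsuc)
open import Data.Product using (Σ; ∃; _×_; _,_)
open import Data.List using (List; []; _∷_; _++_; map)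
open import Data.List.NonEmpty using (List⁺; toList)
open import Data.List.Relation.Unary.All using (All)
open import Data.List.Relation.Binary.Permutation.Propositional using (_↭_)
open import Relation.Binary.PropositionalEquality using (_≢_)
open import Relation.Nullary using (¬_)

-- A disjunctive basis (P , A_P): atoms P and axioms p₁,…,pₙ ⊢ F (n ≥ 1).
record DisjBasis : Set₁ where
  field
    P  : Set
    Ax : List⁺ P → Set

module _ (B : DisjBasis) where
  open DisjBasis B

  -- Contexts Γ are finite lists; Γ , φ is φ ∷ Γ,
  -- Γ , Δ is Γ ++ Δ; exchange and contraction make lists behave as finite sets.
  data Form : Set₁
  data _⊢_ : List Form → Form → Set₁

  infix 4 _⊢_
  infixr 6 _∧_

  data Form where
    atom : P → Form
    T    : Form
    F    : Form
    _∧_  : Form → Form → Form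
    ⩒    : (I : Set) (φ : I → Form) →
           ((i j : I) → i ≢ j → (φ i ∷ φ j ∷ []) ⊢ F) → Form

  data _⊢_ where
    axiom  : (ps : List⁺ P) → Ax ps → map atom (toList ps) ⊢ F
    refl⊢  : ∀ {φ} → (φ ∷ []) ⊢ φ
    weak   : ∀ {Γ φ ψ} → Γ ⊢ ψ → (φ ∷ Γ) ⊢ ψ
    cut    : ∀ {Γ Δ φ ψ} → Γ ⊢ φ → (φ ∷ Δ) ⊢ ψ → (Γ ++ Δ) ⊢ ψ
    F⊢     : ∀ {φ} → (F ∷ []) ⊢ φ
    ⊢T     : [] ⊢ T
    ∧L     : ∀ {Γ φ ψ θ} → (φ ∷ ψ ∷ Γ) ⊢ θ → ((φ ∧ ψ) ∷ Γ) ⊢ θ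
    ∧R     : ∀ {Γ Δ φ ψ} → Γ ⊢ φ → Δ ⊢ ψ → (Γ ++ Δ) ⊢ (φ ∧ ψ)
    ⩒L     : ∀ {Γ θ I φ h} → ((i : I) → (φ i ∷ Γ) ⊢ θ) → (⩒ I φ h ∷ Γ) ⊢ θ
    ⩒R     : ∀ {Γ I φ h} (i : I) → Γ ⊢ φ i → Γ ⊢ ⩒ I φ h
    exch   : ∀ {Γ Δ φ} → Γ ↭ Δ → Γ ⊢ φ → Δ ⊢ φ
    contr  : ∀ {Γ φ ψ} → (φ ∷ φ ∷ Γ) ⊢ ψ → (φ ∷ Γ) ⊢ ψ

  Tautology : Form → Set₁
  Tautology φ = (T ∷ []) ⊢ φ

  Contradiction : Form → Set₁
  Contradiction φ = (φ ∷ []) ⊢ F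

  Satisfiable : Form → Set₁
  Satisfiable φ = ¬ Tautology φ × ¬ Contradiction φ

  data AtomConj : Form → Set₁ where
    atomᶜ : (p : P) → AtomConj (atom p)
    _∧ᶜ_  : ∀ {φ ψ} → AtomConj φ → AtomConj ψ → AtomConj (φ ∧ ψ)

  Conjunction : Form → Set₁
  Conjunction φ = AtomConj φ × Satisfiable φ

  Subset : Set₂
  Subset = Form → Set₁

  _⊆_ : Subset → Subset → Set₁
  S ⊆ S' = ∀ φ → S φ → S' φ

  S1 : Subset → Set₁
  S1 S = ∀ (I : Set) (μ : I → Form) h →
         (∀ i → Conjunction (μ i)) → Satisfiable (⩒ I μ h) →
         S (⩒ I μ h) → ∃ λ i → S (μ i)

  S2 : Subset → Set₁
  S2 S = ∀ Γ φ → All S Γ → Γ ⊢ φ → S φ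

  IsState : Subset → Set₁
  IsState S = (∃ λ φ → S φ) × (∃ λ φ → ¬ S φ) × S1 S × S2 S

  -- A subset of the states, given as a family indexed by K
  Directed : (K : Set₁) → (K → Subset) → Set₁
  Directed K D = K × (∀ k k' → ∃ λ k'' → D k ⊆ D k'' × D k' ⊆ D k'')

  HasLeastState : Set₂
  HasLeastState = Σ Subset λ S → IsState S × (∀ S' → IsState S' → S ⊆ S')

  IsSupState : (K : Set₁) → (K → Subset) → Subset → Set₂
  IsSupState K D S = IsState S × (∀ k → D k ⊆ S) ×
                     (∀ S' → IsState S' → (∀ k → D k ⊆ S') → S ⊆ S')

  StatesPointedDcpo : Set₂
  StatesPointedDcpo =
    HasLeastState ×
    (∀ (K : Set₁) (D : K → Subset) → (∀ k → IsState (D k)) → Directed K D →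
       Σ Subset λ S → IsSupState K D S)

module Submission where

open import Defs
open import Data.Product using (Σ; ∃; _×_; _,_; proj₁; proj₂)
open import Data.List using ([]; _∷_)
open import Data.List.NonEmpty using () renaming (_∷_ to _∷⁺_)
open import Data.List.Relation.Unary.All as All using (All; []; _∷_)
open import Data.List.Relation.Unary.All.Properties using (++⁻ˡ; ++⁻ʳ)
open import Data.List.Relation.Binary.Permutation.Propositional using (↭-sym)
open import Data.List.Relation.Binary.Permutation.Propositional.Properties using (All-resp-↭)
open import Data.Empty using (⊥; ⊥-elim)
open import Data.Unit using (⊤; tt)
open import Relation.Nullary using (¬_)

-- The tautologies form the least state: any state contains T, hence by (S2)
-- every tautology; they form a state because F is not a tautology (soundness
-- for the valuation making every atom false) and (S1) holds vacuously, flat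
-- formulae being satisfiable.  Sequents have finite contexts, so the union of
-- a directed family of states inherits (S2) from a single member, and it is
-- then clearly their supremum.

module _ (B : DisjBasis) where

  ⟦_⟧ : Form B → Set
  ⟦ atom p ⟧    = ⊥
  ⟦ T ⟧         = ⊤
  ⟦ F ⟧         = ⊥
  ⟦ φ ∧ ψ ⟧     = ⟦ φ ⟧ × ⟦ ψ ⟧
  ⟦ ⩒ I φ h ⟧   = Σ I λ i → ⟦ φ i ⟧

  ⊢-sound : ∀ {Γ φ} → _⊢_ B Γ φ → All ⟦_⟧ Γ → ⟦ φ ⟧
  ⊢-sound (axiom (p ∷⁺ ps) ax) (() ∷ _)
  ⊢-sound refl⊢          (x ∷ [])      = x
  ⊢-sound (weak d)       (_ ∷ e)       = ⊢-sound d e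
  ⊢-sound (cut {Γ} d d') e             = ⊢-sound d' (⊢-sound d (++⁻ˡ Γ e) ∷ ++⁻ʳ Γ e)
  ⊢-sound F⊢             (() ∷ [])
  ⊢-sound ⊢T             _             = tt
  ⊢-sound (∧L d)         ((a , b) ∷ e) = ⊢-sound d (a ∷ b ∷ e)
  ⊢-sound (∧R {Γ} d d')  e             = ⊢-sound d (++⁻ˡ Γ e) , ⊢-sound d' (++⁻ʳ Γ e)
  ⊢-sound (⩒L f)         ((i , x) ∷ e) = ⊢-sound (f i) (x ∷ e)
  ⊢-sound (⩒R i d)       e             = i , ⊢-sound d e
  ⊢-sound (exch p d)     e             = ⊢-sound d (All-resp-↭ (↭-sym p) e)
  ⊢-sound (contr d)      (x ∷ e)       = ⊢-sound d (x ∷ x ∷ e)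

  ¬Tautology-F : ¬ Tautology B F
  ¬Tautology-F t = ⊢-sound t (tt ∷ [])

  ⊢-discharge : ∀ Γ {φ} → All (Tautology B) Γ → _⊢_ B Γ φ → _⊢_ B [] φ
  ⊢-discharge []      []       d = d
  ⊢-discharge (_ ∷ Γ) (t ∷ ts) d = ⊢-discharge Γ ts (cut (cut ⊢T t) d)

  Tautology-S2 : S2 B (Tautology B)
  Tautology-S2 Γ φ ts d = weak (⊢-discharge Γ ts d)

  Tautology-isState : IsState B (Tautology B)
  Tautology-isState = (T , refl⊢)
                    , (F , ¬Tautology-F)
                    , (λ I μ h conj sat t → ⊥-elim (proj₁ sat t))
                    , Tautology-S2

  module _ {S : Subset B} (state : IsState B S) where
    private
      S2-S : S2 B S
      S2-S = proj₂ (proj₂ (proj₂ state))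

    state-T : S T
    state-T with proj₁ state
    ... | φ , Sφ = S2-S (φ ∷ []) T (Sφ ∷ []) (weak ⊢T)

    Tautology⊆state : _⊆_ B (Tautology B) S
    Tautology⊆state φ t = S2-S (T ∷ []) φ (state-T ∷ []) t

    F∉state : ¬ S F
    F∉state SF with proj₁ (proj₂ state)
    ... | ψ , ψ∉S = ψ∉S (S2-S (F ∷ []) ψ (SF ∷ []) F⊢)

  module _ (K : Set₁) (D : K → Subset B) (dir : Directed B K D) where

    ⋃ : Subset B
    ⋃ φ = ∃ λ k → D k φ

    All-⋃⇒All-member : ∀ Γ → All ⋃ Γ → ∃ λ k → All (D k) Γ
    All-⋃⇒All-member []      []             = proj₁ dir , []
    All-⋃⇒All-member (φ ∷ Γ) ((k , Dkφ) ∷ us) with All-⋃⇒All-member Γ us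
    ... | k′ , Dk′Γ with proj₂ dir k k′
    ... | k″ , Dk⊆Dk″ , Dk′⊆Dk″ = k″ , Dk⊆Dk″ φ Dkφ ∷ All.map (Dk′⊆Dk″ _) Dk′Γ

    module _ (states : ∀ k → IsState B (D k)) where

      ⋃-S1 : S1 B ⋃
      ⋃-S1 I μ h conj sat (k , x) with states k
      ... | _ , _ , s1 , _ with s1 I μ h conj sat x
      ...   | i , y = i , k , y

      ⋃-S2 : S2 B ⋃
      ⋃-S2 Γ φ us d with All-⋃⇒All-member Γ us
      ... | k , DkΓ with states k
      ...   | _ , _ , _ , s2 = k , s2 Γ φ DkΓ d

      ⋃-isState : IsState B ⋃
      ⋃-isState with proj₁ dir | states (proj₁ dir)
      ... | k₀ | (φ , x) , _ = (φ , k₀ , x) , (F , λ (k , x) → F∉state (states k) x) , ⋃-S1 , ⋃-S2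

      ⋃-isSupState : IsSupState B K D ⋃
      ⋃-isSupState = ⋃-isState , (λ k φ x → k , x) , (λ _ _ ub φ (k , x) → ub k φ x)

lemma3p1 : (B : DisjBasis) → StatesPointedDcpo B
lemma3p1 B = (Tautology B , Tautology-isState B , λ S state → Tautology⊆state B state)
           , (λ K D states dir → ⋃ B K D dir , ⋃-isSupState B K D dir states)
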